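{- Let $G$ be a graph on $n$ vertices with average degree $d>0$. Then $$W_4(G)\ge\frac{W_3(G)^2}{nd}\qquad\text{and}\qquad C_4(G)\ge C_3(G)\Big(\frac{C_3(G)}{nd}-1\Big).$$
   Context: $W_j(G)$ is the number of closed walks of length $j$ in $G$; $C_j(G)$ is the number of closed walks of length $j$ traversing a simple $j$-cycle (each simple $j$-cycle counted $2j$ times). -}

module Defs where

open import Data.Bool using (Bool; true; false; T; _∧_; if_then_else_)
open import Data.Nat as ℕ using (ℕ; zero; suc)
open import Data.Fin using (Fin; _≟_)
open import Data.Fin.Properties using ()
open import Data.List using (List; []; _∷_; map; concatMap; length; filter; allFin)
open import Data.Nat.ListAction using (sum)
open import Data.Vec using (Vec; []; _∷_; head; toList)
open import Data.Integer using (+_)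
open import Data.Rational as ℚ using (ℚ; 0ℚ; _<_; _*_; _/_; NonZero)
import Data.Rational.Properties as ℚP
open import Relation.Nullary.Decidable using (⌊_⌋)
open import Relation.Binary.PropositionalEquality using (_≡_; refl; subst; sym)

record Graph (n : ℕ) : Set where
  field
    adj       : Fin n → Fin n → Bool
    adj-sym   : ∀ u v → adj u v ≡ adj v u
    adj-irref : ∀ v → adj v v ≡ false
open Graph public

allSeqs : (n j : ℕ) → List (Vec (Fin n) j)
allSeqs n zero    = [] ∷ []
allSeqs n (suc j) = concatMap (λ v → map (v ∷_) (allSeqs n j)) (allFin n)

closesWith : ∀ {n k} → Graph n → Fin n → Vec (Fin n) (suc k) → Bool
closesWith G first (v ∷ [])         = adj G v first
closesWith G first (v ∷ w ∷ rest)   = adj G v w ∧ closesWith G first (w ∷ rest)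

-- (v₀, …, v_{j-1}) is a closed walk of length j: v_i ~ v_{i+1} for i < j-1 and v_{j-1} ~ v₀
isClosedWalk : ∀ {n j} → Graph n → Vec (Fin n) j → Bool
isClosedWalk G []            = true
isClosedWalk G (v ∷ rest)    = closesWith G v (v ∷ rest)

notIn : ∀ {n k} → Fin n → Vec (Fin n) k → Bool
notIn v []       = true
notIn v (w ∷ ws) = if ⌊ v ≟ w ⌋ then false else notIn v ws

allDistinct : ∀ {n k} → Vec (Fin n) k → Bool
allDistinct []       = true
allDistinct (v ∷ vs) = notIn v vs ∧ allDistinct vs

countSeqs : (n j : ℕ) → (Vec (Fin n) j → Bool) → ℕ
countSeqs n j p = length (filter (λ w → Data.Bool._≟_ (p w) true) (allSeqs n j))
  where import Data.Bool

W : ∀ {n} → ℕ → Graph n → ℕ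
W {n} j G = countSeqs n j (isClosedWalk G)

-- C_j(G): number of closed walks of length j traversing a simple j-cycle,
-- i.e. closed walks whose j vertices are pairwise distinct
-- (for j ≥ 3 each simple j-cycle is counted 2j times).
C : ∀ {n} → ℕ → Graph n → ℕ
C {n} j G = countSeqs n j (λ w → isClosedWalk G w ∧ allDistinct w)

degree : ∀ {n} → Graph n → Fin n → ℕ
degree {n} G u = length (filter (λ v → Data.Bool._≟_ (adj G u v) true) (allFin n))
  where import Data.Bool

degreeSum : ∀ {n} → Graph n → ℕ
degreeSum {n} G = sum (map (degree G) (allFin n))

avgDeg : ∀ {n} .{{_ : ℕ.NonZero n}} → Graph n → ℚ
avgDeg {n} G = (+ degreeSum G) / n

nℚ : ℕ → ℚ
nℚ n = (+ n) / 1

nd-nonZero : ∀ {n} .{{nz : ℕ.NonZero n}} (G : Graph n) → 0ℚ < avgDeg G → NonZero (nℚ n * avgDeg G)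
nd-nonZero {suc m} G h = ℚ.>-nonZero (subst (_< nℚ (suc m) * avgDeg G) (ℚP.*-zeroʳ (nℚ (suc m))) (ℚP.*-monoʳ-<-pos (nℚ (suc m)) {{ℚP.normalize-pos (suc m) 1}} h))

module Submission where

-- Write A for the 0/1 adjacency matrix of G and codeg a c = Σ_b A a b · A b c for the
-- number of common neighbours of a and c.  Expanding the counts as indicator sums gives
--
--   W₃ = Σ_{a,c} A a c · codeg a c,     nd = Σ_{a,c} A a c,
--
-- and a closed 4-walk (a, b, c, d) is a pair of 2-walks from a to c.  Hence by Cauchy–Schwarz
-- with weights A a c,  W₃² ≤ nd · X  where  X = Σ_{a,c} A a c · codeg a c²  counts the closed
-- 4-walks whose opposite vertices a, c are adjacent.  Trivially X ≤ W₄, which gives the first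
-- inequality.  A closed 4-walk with a ~ c either backtracks (b = d), and those are in bijection
-- with closed 3-walks, or it is a 4-cycle; hence X ≤ C₄ + W₃.  Since every closed 3-walk is a
-- triangle, C₃ = W₃, so C₃² ≤ nd (C₄ + C₃), which is the second inequality.

module Counting where

  open import Data.Bool using (Bool; true; false; _∧_)
  import Data.Bool as Bool
  open import Data.Nat using (ℕ; zero; suc; _+_; _*_; _≤_; z≤n)
  open import Data.Nat.Properties hiding (_≟_)
  open import Data.Nat.Tactic.RingSolver using (solve-∀)
  open import Data.Fin using (Fin; _≟_) renaming (zero to fzero; suc to fsuc)
  open import Data.List using (List; []; _∷_; _++_; map; concatMap; filter; length; tabulate)
  import Data.List.Properties as List
  import Data.Nat.ListAction as List using (sum)
  open import Data.Vec using (Vec; []; _∷_)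
  open import Data.Product using (_,_)
  open import Data.Sum using (_⊎_; inj₁; inj₂)
  open import Function using (_∘_; id)
  open import Relation.Nullary using (yes; no; contradiction)
  open import Relation.Nullary.Decidable using (⌊_⌋)
  open import Relation.Binary.PropositionalEquality
  open import Algebra.Properties.Semiring.Sum +-*-semiring
  open import Defs

  𝟙 : Bool → ℕ
  𝟙 true  = 1
  𝟙 false = 0

  𝟙-∧ : ∀ x y → 𝟙 (x ∧ y) ≡ 𝟙 x * 𝟙 y
  𝟙-∧ true  y = sym (*-identityˡ (𝟙 y))
  𝟙-∧ false y = refl

  𝟙≤1 : ∀ x → 𝟙 x ≤ 1
  𝟙≤1 true  = ≤-refl
  𝟙≤1 false = z≤n

  ∧-redundant : ∀ {x y} → (x ≡ true → y ≡ true) → x ∧ y ≡ x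
  ∧-redundant {true}  x⇒y = x⇒y refl
  ∧-redundant {false} x⇒y = refl

  -- the edge pattern x y y x of a backtracking walk a b c b, combined with z = [c ~ a],
  -- is the edge pattern of the closed walk a b c
  𝟙-backtrack : ∀ x y z → 𝟙 z * 𝟙 (x ∧ (y ∧ (y ∧ x))) ≡ 𝟙 (x ∧ (y ∧ z))
  𝟙-backtrack true  true  z = *-identityʳ (𝟙 z)
  𝟙-backtrack true  false z = *-zeroʳ (𝟙 z)
  𝟙-backtrack false y     z = *-zeroʳ (𝟙 z)

  ≢⇒⌊≟⌋≡false : ∀ {n} {a b : Fin n} → a ≢ b → ⌊ a ≟ b ⌋ ≡ false
  ≢⇒⌊≟⌋≡false {a = a} {b} a≢b with a ≟ b
  ... | yes a≡b = contradiction a≡b a≢b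
  ... | no  _   = refl

  -- a case split on equality that does not abstract over the decision a ≟ b itself
  equal-or-distinct : ∀ {n} (a b : Fin n) → ⌊ a ≟ b ⌋ ≡ true ⊎ a ≢ b
  equal-or-distinct a b with a ≟ b
  ... | yes _   = inj₁ refl
  ... | no  a≢b = inj₂ a≢b

  sum-mono : ∀ {n} {f g : Fin n → ℕ} → (∀ i → f i ≤ g i) → sum f ≤ sum g
  sum-mono {zero}  f≤g = z≤n
  sum-mono {suc n} f≤g = +-mono-≤ (f≤g fzero) (sum-mono (f≤g ∘ fsuc))

  ∑-δ : ∀ {n} (b : Fin n) (f : Fin n → ℕ) → sum (λ d → 𝟙 ⌊ b ≟ d ⌋ * f d) ≡ f b
  ∑-δ {suc n} fzero    f =
    trans (cong (f fzero + 0 +_) (sum-replicate-zero n)) (trans (+-identityʳ _) (+-identityʳ _))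
  ∑-δ {suc n} (fsuc b) f =
    trans (sum-cong-≗ λ d → cong (λ t → 𝟙 t * f (fsuc d)) (suc≟suc b d)) (∑-δ b (f ∘ fsuc))
    where
    suc≟suc : ∀ {n} (b d : Fin n) → ⌊ fsuc b ≟ fsuc d ⌋ ≡ ⌊ b ≟ d ⌋
    suc≟suc b d with b ≟ d
    ... | yes _ = refl
    ... | no  _ = refl

  ∑-*-∑ : ∀ {m n} (f : Fin m → ℕ) (g : Fin n → ℕ) → ∑[ i < m ] ∑[ j < n ] (f i * g j) ≡ sum f * sum g
  ∑-*-∑ f g = trans (sum-cong-≗ λ i → sym (*-distribˡ-sum (f i) g)) (sym (*-distribʳ-sum (sum g) f))

  four-mul≤square-ordered : ∀ {x y} → x ≤ y → 4 * (x * y) ≤ (x + y) * (x + y)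
  four-mul≤square-ordered {x} x≤y with k , refl ← m≤n⇒∃[o]m+o≡n x≤y =
    subst (4 * (x * (x + k)) ≤_) (gap x k) (m≤m+n _ (k * k))
    where
    gap : ∀ x k → 4 * (x * (x + k)) + k * k ≡ (x + (x + k)) * (x + (x + k))
    gap = solve-∀

  four-mul≤square : ∀ x y → 4 * (x * y) ≤ (x + y) * (x + y)
  four-mul≤square x y with ≤-total x y
  ... | inj₁ x≤y = four-mul≤square-ordered x≤y
  ... | inj₂ y≤x = subst₂ (λ p q → 4 * p ≤ q * q) (*-comm y x) (+-comm y x) (four-mul≤square-ordered y≤x)

  square-cancel-≤ : ∀ {m n} → m * m ≤ n * n → m ≤ n
  square-cancel-≤ m²≤n² = ≮⇒≥ λ n<m → <⇒≱ (*-mono-< n<m n<m) m²≤n²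

  cauchySchwarz-+ : ∀ {t s u t′ s′ u′} → t * t ≤ s * u → t′ * t′ ≤ s′ * u′ →
                    (t + t′) * (t + t′) ≤ (s + s′) * (u + u′)
  cauchySchwarz-+ {t} {s} {u} {t′} {s′} {u′} h h′ = begin
    (t + t′) * (t + t′)                  ≡⟨ expandˡ t t′ ⟩
    t * t + 2 * (t * t′) + t′ * t′       ≤⟨ +-mono-≤ (+-mono-≤ h cross) h′ ⟩
    s * u + (s * u′ + s′ * u) + s′ * u′  ≡⟨ expandʳ s s′ u u′ ⟩
    (s + s′) * (u + u′)                  ∎
    where
    open ≤-Reasoning
    expandˡ : ∀ t t′ → (t + t′) * (t + t′) ≡ t * t + 2 * (t * t′) + t′ * t′
    expandˡ = solve-∀
    expandʳ : ∀ s s′ u u′ → s * u + (s * u′ + s′ * u) + s′ * u′ ≡ (s + s′) * (u + u′)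
    expandʳ = solve-∀
    square-of-double : ∀ t t′ → 2 * (t * t′) * (2 * (t * t′)) ≡ 4 * ((t * t) * (t′ * t′))
    square-of-double = solve-∀
    swap-factors : ∀ s s′ u u′ → 4 * ((s * u) * (s′ * u′)) ≡ 4 * ((s * u′) * (s′ * u))
    swap-factors = solve-∀
    cross : 2 * (t * t′) ≤ s * u′ + s′ * u
    cross = square-cancel-≤ (begin
      2 * (t * t′) * (2 * (t * t′))          ≡⟨ square-of-double t t′ ⟩
      4 * ((t * t) * (t′ * t′))              ≤⟨ *-monoʳ-≤ 4 (*-mono-≤ h h′) ⟩
      4 * ((s * u) * (s′ * u′))              ≡⟨ swap-factors s s′ u u′ ⟩
      4 * ((s * u′) * (s′ * u))              ≤⟨ four-mul≤square (s * u′) (s′ * u) ⟩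
      (s * u′ + s′ * u) * (s * u′ + s′ * u)  ∎)

  cauchySchwarz-∑ : ∀ {n} (t s u : Fin n → ℕ) → (∀ i → t i * t i ≤ s i * u i) →
                    sum t * sum t ≤ sum s * sum u
  cauchySchwarz-∑ {zero}  t s u h = z≤n
  cauchySchwarz-∑ {suc n} t s u h =
    cauchySchwarz-+ {t fzero} {s fzero} {u fzero} {sum (t ∘ fsuc)} {sum (s ∘ fsuc)} {sum (u ∘ fsuc)}
      (h fzero) (cauchySchwarz-∑ (t ∘ fsuc) (s ∘ fsuc) (u ∘ fsuc) (h ∘ fsuc))

  count : {A : Set} → (A → Bool) → List A → ℕ
  count p xs = length (filter (λ x → p x Bool.≟ true) xs)

  count-∷ : {A : Set} (p : A → Bool) (x : A) (xs : List A) → count p (x ∷ xs) ≡ 𝟙 (p x) + count p xs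
  count-∷ p x xs with p x
  ... | true  = refl
  ... | false = refl

  count-++ : {A : Set} (p : A → Bool) (xs ys : List A) → count p (xs ++ ys) ≡ count p xs + count p ys
  count-++ p xs ys = trans (cong length (List.filter-++ _ xs ys)) (List.length-++ (filter _ xs))

  count-map : {A B : Set} (p : B → Bool) (f : A → B) (xs : List A) → count p (map f xs) ≡ count (p ∘ f) xs
  count-map p f []       = refl
  count-map p f (x ∷ xs) = begin
    count p (map f (x ∷ xs))          ≡⟨ count-∷ p (f x) (map f xs) ⟩
    𝟙 (p (f x)) + count p (map f xs)  ≡⟨ cong (𝟙 (p (f x)) +_) (count-map p f xs) ⟩
    𝟙 (p (f x)) + count (p ∘ f) xs    ≡⟨ count-∷ (p ∘ f) x xs ⟨
    count (p ∘ f) (x ∷ xs)            ∎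
    where open ≡-Reasoning

  count-tabulate : ∀ {A : Set} {n} (p : A → Bool) (f : Fin n → A) →
                   count p (tabulate f) ≡ ∑[ i < n ] 𝟙 (p (f i))
  count-tabulate {n = zero}  p f = refl
  count-tabulate {n = suc n} p f =
    trans (count-∷ p (f fzero) _) (cong (𝟙 (p (f fzero)) +_) (count-tabulate p (f ∘ fsuc)))

  count-concatMap-tabulate : ∀ {A B : Set} {n} (p : B → Bool) (f : A → List B) (g : Fin n → A) →
                             count p (concatMap f (tabulate g)) ≡ ∑[ i < n ] count p (f (g i))
  count-concatMap-tabulate {n = zero}  p f g = refl
  count-concatMap-tabulate {n = suc n} p f g =
    trans (count-++ p (f (g fzero)) _) (cong (count p (f (g fzero)) +_) (count-concatMap-tabulate p f (g ∘ fsuc)))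

  listSum-tabulate : ∀ {n} (f : Fin n → ℕ) → List.sum (tabulate f) ≡ sum f
  listSum-tabulate {zero}  f = refl
  listSum-tabulate {suc n} f = cong (f fzero +_) (listSum-tabulate (f ∘ fsuc))

  ∑Seq : (n j : ℕ) → (Vec (Fin n) j → ℕ) → ℕ
  ∑Seq n zero    f = f []
  ∑Seq n (suc j) f = ∑[ v < n ] ∑Seq n j (λ w → f (v ∷ w))

  countSeqs-∑Seq : ∀ n j (p : Vec (Fin n) j → Bool) → countSeqs n j p ≡ ∑Seq n j (𝟙 ∘ p)
  countSeqs-∑Seq n zero    p = trans (count-∷ p [] []) (+-identityʳ (𝟙 (p [])))
  countSeqs-∑Seq n (suc j) p = begin
    countSeqs n (suc j) p                          ≡⟨ count-concatMap-tabulate p (λ v → map (v ∷_) (allSeqs n j)) id ⟩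
    ∑[ v < n ] count p (map (v ∷_) (allSeqs n j))  ≡⟨ sum-cong-≗ (λ v → count-map p (v ∷_) (allSeqs n j)) ⟩
    ∑[ v < n ] countSeqs n j (λ w → p (v ∷ w))     ≡⟨ sum-cong-≗ (λ v → countSeqs-∑Seq n j (λ w → p (v ∷ w))) ⟩
    ∑Seq n (suc j) (𝟙 ∘ p)                          ∎
    where open ≡-Reasoning

  ∑Seq-cong : ∀ n j (f g : Vec (Fin n) j → ℕ) → (∀ w → f w ≡ g w) → ∑Seq n j f ≡ ∑Seq n j g
  ∑Seq-cong n zero    f g f≡g = f≡g []
  ∑Seq-cong n (suc j) f g f≡g =
    sum-cong-≗ λ v → ∑Seq-cong n j (λ w → f (v ∷ w)) (λ w → g (v ∷ w)) (λ w → f≡g (v ∷ w))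

  ∑Seq-mono : ∀ n j (f g : Vec (Fin n) j → ℕ) → (∀ w → f w ≤ g w) → ∑Seq n j f ≤ ∑Seq n j g
  ∑Seq-mono n zero    f g f≤g = f≤g []
  ∑Seq-mono n (suc j) f g f≤g =
    sum-mono λ v → ∑Seq-mono n j (λ w → f (v ∷ w)) (λ w → g (v ∷ w)) (λ w → f≤g (v ∷ w))

  ∑Seq-+ : ∀ n j (f g : Vec (Fin n) j → ℕ) → ∑Seq n j (λ w → f w + g w) ≡ ∑Seq n j f + ∑Seq n j g
  ∑Seq-+ n zero    f g = refl
  ∑Seq-+ n (suc j) f g =
    trans (sum-cong-≗ λ v → ∑Seq-+ n j (λ w → f (v ∷ w)) (λ w → g (v ∷ w)))
          (∑-distrib-+ (λ v → ∑Seq n j (λ w → f (v ∷ w))) (λ v → ∑Seq n j (λ w → g (v ∷ w))))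

  module ClosedWalks {n : ℕ} (G : Graph n) where

    A : Fin n → Fin n → ℕ
    A u v = 𝟙 (adj G u v)

    A-sym : ∀ u v → A u v ≡ A v u
    A-sym u v = cong 𝟙 (adj-sym G u v)

    adj⇒≢ : ∀ {u v} → adj G u v ≡ true → u ≢ v
    adj⇒≢ {u} uv refl with trans (sym uv) (adj-irref G u)
    ... | ()

    codeg : Fin n → Fin n → ℕ
    codeg a c = ∑[ b < n ] (A a b * A b c)

    triangle : ∀ a b c → 𝟙 (isClosedWalk G (a ∷ b ∷ c ∷ [])) ≡ A a c * (A a b * A b c)
    triangle a b c = begin
      𝟙 (adj G a b ∧ (adj G b c ∧ adj G c a))  ≡⟨ trans (𝟙-∧ (adj G a b) _) (cong (A a b *_) (𝟙-∧ (adj G b c) _)) ⟩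
      A a b * (A b c * A c a)                  ≡⟨ cong (λ t → A a b * (A b c * t)) (A-sym c a) ⟩
      A a b * (A b c * A a c)                  ≡⟨ rotate (A a b) (A b c) (A a c) ⟩
      A a c * (A a b * A b c)                  ∎
      where
      open ≡-Reasoning
      rotate : ∀ x y z → x * (y * z) ≡ z * (x * y)
      rotate x y z = trans (sym (*-assoc x y z)) (*-comm (x * y) z)

    square : ∀ a b c d → 𝟙 (isClosedWalk G (a ∷ b ∷ c ∷ d ∷ [])) ≡ (A a b * A b c) * (A a d * A d c)
    square a b c d = begin
      𝟙 (adj G a b ∧ (adj G b c ∧ (adj G c d ∧ adj G d a)))
        ≡⟨ trans (𝟙-∧ (adj G a b) _)
             (cong (A a b *_) (trans (𝟙-∧ (adj G b c) _) (cong (A b c *_) (𝟙-∧ (adj G c d) _)))) ⟩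
      A a b * (A b c * (A c d * A d a))
        ≡⟨ cong₂ (λ s t → A a b * (A b c * (s * t))) (A-sym c d) (A-sym d a) ⟩
      A a b * (A b c * (A d c * A a d))
        ≡⟨ regroup (A a b) (A b c) (A d c) (A a d) ⟩
      (A a b * A b c) * (A a d * A d c)
        ∎
      where
      open ≡-Reasoning
      regroup : ∀ x y u v → x * (y * (u * v)) ≡ (x * y) * (v * u)
      regroup = solve-∀

    W3-codeg : W 3 G ≡ ∑[ a < n ] ∑[ c < n ] (A a c * codeg a c)
    W3-codeg = begin
      W 3 G
        ≡⟨ countSeqs-∑Seq n 3 (isClosedWalk G) ⟩
      ∑[ a < n ] ∑[ b < n ] ∑[ c < n ] 𝟙 (isClosedWalk G (a ∷ b ∷ c ∷ []))
        ≡⟨ sum-cong-≗ (λ a → sum-cong-≗ λ b → sum-cong-≗ λ c → triangle a b c) ⟩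
      ∑[ a < n ] ∑[ b < n ] ∑[ c < n ] (A a c * (A a b * A b c))
        ≡⟨ sum-cong-≗ (λ a → ∑-comm (λ b c → A a c * (A a b * A b c))) ⟩
      ∑[ a < n ] ∑[ c < n ] ∑[ b < n ] (A a c * (A a b * A b c))
        ≡⟨ sum-cong-≗ (λ a → sum-cong-≗ λ c → sym (*-distribˡ-sum (A a c) (λ b → A a b * A b c))) ⟩
      ∑[ a < n ] ∑[ c < n ] (A a c * codeg a c)
        ∎
      where open ≡-Reasoning

    degreeSum-A : degreeSum G ≡ ∑[ a < n ] ∑[ c < n ] A a c
    degreeSum-A = begin
      List.sum (map (degree G) (tabulate id))  ≡⟨ cong List.sum (List.map-tabulate id (degree G)) ⟩
      List.sum (tabulate (degree G))           ≡⟨ listSum-tabulate (degree G) ⟩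
      ∑[ a < n ] degree G a                    ≡⟨ sum-cong-≗ (λ a → count-tabulate (adj G a) id) ⟩
      ∑[ a < n ] ∑[ c < n ] A a c              ∎
      where open ≡-Reasoning

    weightedClosed4 : (Fin n → Fin n → ℕ) → Vec (Fin n) 4 → ℕ
    weightedClosed4 φ (a ∷ b ∷ c ∷ d ∷ []) = φ a c * 𝟙 (isClosedWalk G (a ∷ b ∷ c ∷ d ∷ []))

    weightedW4 : (Fin n → Fin n → ℕ) → ℕ
    weightedW4 φ = ∑Seq n 4 (weightedClosed4 φ)

    -- a closed 4-walk is a pair of 2-walks a → c, so weightedW4 φ = Σ_{a,c} φ a c · codeg a c²
    weightedW4-codeg : ∀ φ → weightedW4 φ ≡ ∑[ a < n ] ∑[ c < n ] (φ a c * (codeg a c * codeg a c))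
    weightedW4-codeg φ = sum-cong-≗ λ a → begin
      ∑[ b < n ] ∑[ c < n ] ∑[ d < n ] (φ a c * 𝟙 (isClosedWalk G (a ∷ b ∷ c ∷ d ∷ [])))
        ≡⟨ sum-cong-≗ (λ b → sum-cong-≗ λ c → sum-cong-≗ λ d → cong (φ a c *_) (square a b c d)) ⟩
      ∑[ b < n ] ∑[ c < n ] ∑[ d < n ] (φ a c * ((A a b * A b c) * (A a d * A d c)))
        ≡⟨ ∑-comm (λ b c → ∑[ d < n ] (φ a c * ((A a b * A b c) * (A a d * A d c)))) ⟩
      ∑[ c < n ] ∑[ b < n ] ∑[ d < n ] (φ a c * ((A a b * A b c) * (A a d * A d c)))
        ≡⟨ sum-cong-≗ (λ c → trans (sum-cong-≗ {n} λ b → sum-cong-≗ {n} λ d → sym (*-assoc (φ a c) _ _))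
                                   (∑-*-∑ (λ b → φ a c * (A a b * A b c)) (λ d → A a d * A d c))) ⟩
      ∑[ c < n ] (∑[ b < n ] (φ a c * (A a b * A b c)) * codeg a c)
        ≡⟨ sum-cong-≗ (λ c → trans (cong (_* codeg a c) (sym (*-distribˡ-sum (φ a c) (λ b → A a b * A b c))))
                                   (*-assoc (φ a c) (codeg a c) (codeg a c))) ⟩
      ∑[ c < n ] (φ a c * (codeg a c * codeg a c))
        ∎
      where open ≡-Reasoning

    W4-weighted : W 4 G ≡ weightedW4 (λ _ _ → 1)
    W4-weighted = trans (countSeqs-∑Seq n 4 (isClosedWalk G))
      (∑Seq-cong n 4 (𝟙 ∘ isClosedWalk G) (weightedClosed4 (λ _ _ → 1))
        λ { (a ∷ b ∷ c ∷ d ∷ []) → sym (*-identityˡ _) })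

    -- closed 4-walks whose opposite vertices a and c are adjacent
    X : ℕ
    X = weightedW4 A

    -- Cauchy–Schwarz with weights A a c applied to codeg a c
    W3²≤degreeSum·X : W 3 G * W 3 G ≤ degreeSum G * X
    W3²≤degreeSum·X = begin
      W 3 G * W 3 G
        ≡⟨ cong₂ _*_ W3-codeg W3-codeg ⟩
      (∑[ a < n ] ∑[ c < n ] (A a c * codeg a c)) * (∑[ a < n ] ∑[ c < n ] (A a c * codeg a c))
        ≤⟨ cauchySchwarz-∑ _ _ _ (λ a → cauchySchwarz-∑ _ _ _ λ c →
             ≤-reflexive (weighted-square (A a c) (codeg a c))) ⟩
      (∑[ a < n ] ∑[ c < n ] A a c) * (∑[ a < n ] ∑[ c < n ] (A a c * (codeg a c * codeg a c)))
        ≡⟨ cong₂ _*_ (sym degreeSum-A) (sym (weightedW4-codeg A)) ⟩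
      degreeSum G * X
        ∎
      where
      open ≤-Reasoning
      weighted-square : ∀ w y → (w * y) * (w * y) ≡ w * (w * (y * y))
      weighted-square = solve-∀

    X≤W4 : X ≤ W 4 G
    X≤W4 = subst (X ≤_) (sym W4-weighted)
      (∑Seq-mono n 4 (weightedClosed4 A) (weightedClosed4 (λ _ _ → 1))
        λ { (a ∷ b ∷ c ∷ d ∷ []) → *-monoˡ-≤ _ (𝟙≤1 (adj G a c)) })

    triangle-distinct : ∀ a b c → isClosedWalk G (a ∷ b ∷ c ∷ []) ≡ true →
                        allDistinct (a ∷ b ∷ c ∷ []) ≡ true
    triangle-distinct a b c closed with adj G a b in ab | adj G b c in bc | adj G c a in ca
    ... | true | true | true
      rewrite ≢⇒⌊≟⌋≡false (adj⇒≢ ab) | ≢⇒⌊≟⌋≡false (≢-sym (adj⇒≢ ca)) | ≢⇒⌊≟⌋≡false (adj⇒≢ bc) = refl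

    C3≡W3 : C 3 G ≡ W 3 G
    C3≡W3 = begin
      C 3 G
        ≡⟨ countSeqs-∑Seq n 3 _ ⟩
      ∑Seq n 3 (λ w → 𝟙 (isClosedWalk G w ∧ allDistinct w))
        ≡⟨ ∑Seq-cong n 3 (λ w → 𝟙 (isClosedWalk G w ∧ allDistinct w)) (𝟙 ∘ isClosedWalk G)
             (λ { (a ∷ b ∷ c ∷ []) → cong 𝟙 (∧-redundant (triangle-distinct a b c)) }) ⟩
      ∑Seq n 3 (𝟙 ∘ isClosedWalk G)
        ≡⟨ countSeqs-∑Seq n 3 _ ⟨
      W 3 G
        ∎
      where open ≡-Reasoning

    square-distinct : ∀ a b c d → adj G a c ≡ true → b ≢ d → isClosedWalk G (a ∷ b ∷ c ∷ d ∷ []) ≡ true →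
                      allDistinct (a ∷ b ∷ c ∷ d ∷ []) ≡ true
    square-distinct a b c d ac b≢d closed
      with adj G a b in ab | adj G b c in bc | adj G c d in cd | adj G d a in da
    ... | true | true | true | true
      rewrite ≢⇒⌊≟⌋≡false (adj⇒≢ ab) | ≢⇒⌊≟⌋≡false (adj⇒≢ ac) | ≢⇒⌊≟⌋≡false (≢-sym (adj⇒≢ da))
            | ≢⇒⌊≟⌋≡false (adj⇒≢ bc) | ≢⇒⌊≟⌋≡false b≢d | ≢⇒⌊≟⌋≡false (adj⇒≢ cd) = refl

    -- pointwise form of X ≤ C₄ + W₃: a walk counted by X is a 4-cycle or backtracks (b = d)
    cycle-or-backtrack : ∀ a b c d → let closed = isClosedWalk G (a ∷ b ∷ c ∷ d ∷ []) in
      A a c * 𝟙 closed ≤ 𝟙 (closed ∧ allDistinct (a ∷ b ∷ c ∷ d ∷ [])) + 𝟙 ⌊ b ≟ d ⌋ * (A a c * 𝟙 closed)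
    cycle-or-backtrack a b c d with adj G a c in ac
    ... | false = z≤n
    ... | true with isClosedWalk G (a ∷ b ∷ c ∷ d ∷ []) in closed
    ...   | false = z≤n
    ...   | true with equal-or-distinct b d
    ...     | inj₁ b≡d rewrite b≡d = m≤n+m 1 _
    ...     | inj₂ b≢d rewrite square-distinct a b c d ac b≢d closed = m≤m+n 1 _

    backtrack4 : Vec (Fin n) 4 → ℕ
    backtrack4 (a ∷ b ∷ c ∷ d ∷ []) = 𝟙 ⌊ b ≟ d ⌋ * weightedClosed4 A (a ∷ b ∷ c ∷ d ∷ [])

    backtrack-closed : ∀ a b c →
      A a c * 𝟙 (isClosedWalk G (a ∷ b ∷ c ∷ b ∷ [])) ≡ 𝟙 (isClosedWalk G (a ∷ b ∷ c ∷ []))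
    backtrack-closed a b c =
      trans (cong₂ (λ z t → 𝟙 z * 𝟙 (adj G a b ∧ (adj G b c ∧ t))) (adj-sym G a c)
                   (cong₂ _∧_ (adj-sym G c b) (adj-sym G b a)))
            (𝟙-backtrack (adj G a b) (adj G b c) (adj G c a))

    -- backtracking walks a b c b with a ~ c are exactly the closed 3-walks a b c
    backtracks-W3 : ∑Seq n 4 backtrack4 ≡ W 3 G
    backtracks-W3 = begin
      ∑Seq n 4 backtrack4
        ≡⟨ sum-cong-≗ (λ a → sum-cong-≗ λ b → sum-cong-≗ λ c →
             ∑-δ b (λ d → weightedClosed4 A (a ∷ b ∷ c ∷ d ∷ []))) ⟩
      ∑[ a < n ] ∑[ b < n ] ∑[ c < n ] (A a c * 𝟙 (isClosedWalk G (a ∷ b ∷ c ∷ b ∷ [])))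
        ≡⟨ sum-cong-≗ (λ a → sum-cong-≗ λ b → sum-cong-≗ λ c → backtrack-closed a b c) ⟩
      ∑Seq n 3 (𝟙 ∘ isClosedWalk G)
        ≡⟨ countSeqs-∑Seq n 3 _ ⟨
      W 3 G
        ∎
      where open ≡-Reasoning

    X≤C4+W3 : X ≤ C 4 G + W 3 G
    X≤C4+W3 = begin
      ∑Seq n 4 (weightedClosed4 A)
        ≤⟨ ∑Seq-mono n 4 (weightedClosed4 A) (λ w → cycle4 w + backtrack4 w)
             (λ { (a ∷ b ∷ c ∷ d ∷ []) → cycle-or-backtrack a b c d }) ⟩
      ∑Seq n 4 (λ w → cycle4 w + backtrack4 w)
        ≡⟨ ∑Seq-+ n 4 cycle4 backtrack4 ⟩
      ∑Seq n 4 cycle4 + ∑Seq n 4 backtrack4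
        ≡⟨ cong₂ _+_ (sym (countSeqs-∑Seq n 4 _)) backtracks-W3 ⟩
      C 4 G + W 3 G
        ∎
      where
      open ≤-Reasoning
      cycle4 : Vec (Fin n) 4 → ℕ
      cycle4 w = 𝟙 (isClosedWalk G w ∧ allDistinct w)

    W3²≤W4·degreeSum : W 3 G * W 3 G ≤ W 4 G * degreeSum G
    W3²≤W4·degreeSum = ≤-trans W3²≤degreeSum·X
      (≤-trans (*-monoʳ-≤ (degreeSum G) X≤W4) (≤-reflexive (*-comm (degreeSum G) (W 4 G))))

    C3²≤[C4+C3]·degreeSum : C 3 G * C 3 G ≤ (C 4 G + C 3 G) * degreeSum G
    C3²≤[C4+C3]·degreeSum rewrite C3≡W3 = ≤-trans W3²≤degreeSum·X
      (≤-trans (*-monoʳ-≤ (degreeSum G) X≤C4+W3) (≤-reflexive (*-comm (degreeSum G) (C 4 G + W 3 G))))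

module Embedding where

  open import Data.Nat as ℕ using (ℕ; suc)
  open import Data.Integer as ℤ using (+_)
  import Data.Integer.Properties as ℤ
  open import Data.Integer.Tactic.RingSolver using (solve-∀)
  open import Data.Rational
    using (ℚ; 0ℚ; 1ℚ; _≤_; _<_; _+_; _*_; _-_; -_; _÷_; _/_; 1/_; NonZero; Positive; NonNegative; positive; fromℚᵘ)
  open import Data.Rational.Properties
  open import Data.Rational.Unnormalised as ℚᵘ using (mkℚᵘ; *≡*; *≤*)
  import Data.Rational.Unnormalised.Properties as ℚᵘ
  open import Relation.Binary.PropositionalEquality

  -- the embedding ℕ → ℚ used in the statement; note ι a is definitionally fromℚᵘ (mkℚᵘ (+ a) 0)
  ι : ℕ → ℚ
  ι a = (+ a) / 1

  fromℚᵘ-homo-* : ∀ p q → fromℚᵘ p * fromℚᵘ q ≡ fromℚᵘ (p ℚᵘ.* q)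
  fromℚᵘ-homo-* p q = toℚᵘ-injective (ℚᵘ.≃-trans (toℚᵘ-homo-* (fromℚᵘ p) (fromℚᵘ q))
    (ℚᵘ.≃-trans (ℚᵘ.*-cong (toℚᵘ-fromℚᵘ p) (toℚᵘ-fromℚᵘ q)) (ℚᵘ.≃-sym (toℚᵘ-fromℚᵘ (p ℚᵘ.* q)))))

  fromℚᵘ-homo-+ : ∀ p q → fromℚᵘ p + fromℚᵘ q ≡ fromℚᵘ (p ℚᵘ.+ q)
  fromℚᵘ-homo-+ p q = toℚᵘ-injective (ℚᵘ.≃-trans (toℚᵘ-homo-+ (fromℚᵘ p) (fromℚᵘ q))
    (ℚᵘ.≃-trans (ℚᵘ.+-cong (toℚᵘ-fromℚᵘ p) (toℚᵘ-fromℚᵘ q)) (ℚᵘ.≃-sym (toℚᵘ-fromℚᵘ (p ℚᵘ.+ q)))))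

  fromℚᵘ-mono-≤ : ∀ {p q} → p ℚᵘ.≤ q → fromℚᵘ p ≤ fromℚᵘ q
  fromℚᵘ-mono-≤ {p} {q} p≤q = toℚᵘ-cancel-≤
    (ℚᵘ.≤-respˡ-≃ (ℚᵘ.≃-sym (toℚᵘ-fromℚᵘ p)) (ℚᵘ.≤-respʳ-≃ (ℚᵘ.≃-sym (toℚᵘ-fromℚᵘ q)) p≤q))

  ι-via : ∀ p a → p ℚᵘ.≃ mkℚᵘ (+ a) 0 → fromℚᵘ p ≡ ι a
  ι-via p a = fromℚᵘ-cong {p} {mkℚᵘ (+ a) 0}

  ι-* : ∀ a b → ι a * ι b ≡ ι (a ℕ.* b)
  ι-* a b = trans (fromℚᵘ-homo-* (mkℚᵘ (+ a) 0) (mkℚᵘ (+ b) 0))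
    (ι-via (mkℚᵘ (+ a) 0 ℚᵘ.* mkℚᵘ (+ b) 0) (a ℕ.* b) (*≡* (cong (ℤ._* + 1) (sym (ℤ.pos-* a b)))))

  ι-+ : ∀ a b → ι a + ι b ≡ ι (a ℕ.+ b)
  ι-+ a b = trans (fromℚᵘ-homo-+ (mkℚᵘ (+ a) 0) (mkℚᵘ (+ b) 0))
    (ι-via (mkℚᵘ (+ a) 0 ℚᵘ.+ mkℚᵘ (+ b) 0) (a ℕ.+ b) (*≡* (cong (ℤ._* + 1) sum-pos)))
    where
    sum-pos : + a ℤ.* + 1 ℤ.+ + b ℤ.* + 1 ≡ + (a ℕ.+ b)
    sum-pos = trans (cong₂ ℤ._+_ (ℤ.*-identityʳ (+ a)) (ℤ.*-identityʳ (+ b))) (sym (ℤ.pos-+ a b))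

  ι-mono : ∀ {a b} → a ℕ.≤ b → ι a ≤ ι b
  ι-mono {a} {b} a≤b = fromℚᵘ-mono-≤ {mkℚᵘ (+ a) 0} {mkℚᵘ (+ b) 0} (*≤* (ℤ.*-monoʳ-≤-nonNeg (+ 1) (ℤ.+≤+ a≤b)))

  ι-mono-* : ∀ a b c d → a ℕ.* b ℕ.≤ c ℕ.* d → ι a * ι b ≤ ι c * ι d
  ι-mono-* a b c d ab≤cd = subst₂ _≤_ (sym (ι-* a b)) (sym (ι-* c d)) (ι-mono ab≤cd)

  n*[D/n] : ∀ m D → ι (suc m) * ((+ D) / suc m) ≡ ι D
  n*[D/n] m D = trans (fromℚᵘ-homo-* (mkℚᵘ (+ suc m) 0) (mkℚᵘ (+ D) m))
    (ι-via (mkℚᵘ (+ suc m) 0 ℚᵘ.* mkℚᵘ (+ D) m) D (*≡* (rearrange (+ suc m) (+ D))))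
    where
    rearrange : ∀ p q → (p ℤ.* q) ℤ.* + 1 ≡ q ℤ.* (+ 1 ℤ.* p)
    rearrange = solve-∀

  ÷-≤ : ∀ p q r .{{_ : NonZero q}} → 0ℚ < q → p ≤ r * q → p ÷ q ≤ r
  ÷-≤ p q r 0<q p≤rq = begin
    p * 1/ q        ≤⟨ *-monoʳ-≤-nonNeg _ {{1/q≥0}} p≤rq ⟩
    r * q * 1/ q    ≡⟨ *-assoc r q (1/ q) ⟩
    r * (q * 1/ q)  ≡⟨ cong (r *_) (*-inverseʳ q) ⟩
    r * 1ℚ          ≡⟨ *-identityʳ r ⟩
    r               ∎
    where
    open ≤-Reasoning
    q>0 : Positive q
    q>0 = positive 0<q
    1/q≥0 : NonNegative ((1/ q) {{pos⇒nonZero q {{q>0}}}})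
    1/q≥0 = pos⇒nonNeg ((1/ q) {{pos⇒nonZero q {{q>0}}}}) {{1/pos⇒pos q {{q>0}}}}

  ÷-≤-shifted : ∀ x y c q .{{_ : NonZero q}} → 0ℚ < q → x * y ≤ (c + x) * q → x * (y ÷ q - 1ℚ) ≤ c
  ÷-≤-shifted x y c q 0<q xy≤[c+x]q = begin
    x * (y * 1/ q - 1ℚ)        ≡⟨ *-distribˡ-+ x (y * 1/ q) (- 1ℚ) ⟩
    x * (y * 1/ q) + x * - 1ℚ  ≡⟨ cong₂ _+_ (sym (*-assoc x y (1/ q))) x*-1 ⟩
    (x * y) ÷ q - x            ≤⟨ +-monoˡ-≤ (- x) (÷-≤ (x * y) q (c + x) 0<q xy≤[c+x]q) ⟩
    (c + x) - x                ≡⟨ +-assoc c x (- x) ⟩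
    c + (x - x)                ≡⟨ cong (λ z → c + z) (+-inverseʳ x) ⟩
    c + 0ℚ                     ≡⟨ +-identityʳ c ⟩
    c                          ∎
    where
    open ≤-Reasoning
    x*-1 : x * - 1ℚ ≡ - x
    x*-1 = trans (sym (neg-distribʳ-* x 1ℚ)) (cong -_ (*-identityʳ x))

open import Defs
open import Data.Nat using (ℕ; NonZero)
open import Data.Integer using (+_)
open import Data.Product using (_×_; _,_)
open import Data.Rational using (ℚ; 0ℚ; 1ℚ; _<_; _≤_; _*_; _-_; _÷_; _/_)
import Data.Nat as ℕ
import Data.Rational as ℚ
open import Data.Rational.Properties using (*-zeroʳ; *-monoʳ-<-pos; normalize-pos)
open import Relation.Binary.PropositionalEquality using (_≡_; subst; subst₂; sym)
open Counting using (module ClosedWalks)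
open Embedding

mainTheorem17 : (n : ℕ) .{{_ : NonZero n}} (G : Graph n) → (d>0 : 0ℚ < avgDeg G) →
    ((((+ W 3 G) / 1) * ((+ W 3 G) / 1)) ÷ (nℚ n * avgDeg G)) {{nd-nonZero G d>0}} ≤ (+ W 4 G) / 1
    × ((+ C 3 G) / 1) * ((((+ C 3 G) / 1) ÷ (nℚ n * avgDeg G)) {{nd-nonZero G d>0}} - 1ℚ) ≤ (+ C 4 G) / 1
mainTheorem17 n@(ℕ.suc m) G d>0 =
    ÷-≤ (ι (W 3 G) * ι (W 3 G)) nd (ι (W 4 G)) {{nd-nonZero G d>0}} nd>0 W-bound
  , ÷-≤-shifted (ι (C 3 G)) (ι (C 3 G)) (ι (C 4 G)) nd {{nd-nonZero G d>0}} nd>0 C-bound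
  where
  open ClosedWalks G
  nd : ℚ
  nd = nℚ n * avgDeg G
  nd≡D : ι (degreeSum G) ≡ nd
  nd≡D = sym (n*[D/n] m (degreeSum G))
  nd>0 : 0ℚ < nd
  nd>0 = subst (_< nd) (*-zeroʳ (nℚ n)) (*-monoʳ-<-pos (nℚ n) {{normalize-pos n 1}} d>0)
  W-bound : ι (W 3 G) * ι (W 3 G) ≤ ι (W 4 G) * nd
  W-bound = subst (λ q → ι (W 3 G) * ι (W 3 G) ≤ ι (W 4 G) * q) nd≡D
    (ι-mono-* (W 3 G) (W 3 G) (W 4 G) (degreeSum G) W3²≤W4·degreeSum)
  C-bound : ι (C 3 G) * ι (C 3 G) ≤ (ι (C 4 G) ℚ.+ ι (C 3 G)) * nd
  C-bound = subst₂ (λ p q → ι (C 3 G) * ι (C 3 G) ≤ p * q) (sym (ι-+ (C 4 G) (C 3 G))) nd≡D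
    (ι-mono-* (C 3 G) (C 3 G) (C 4 G ℕ.+ C 3 G) (degreeSum G) C3²≤[C4+C3]·degreeSum)
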